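{- Neither CCS$^{sg}$ nor CCS$^{\mathsf{prio}}$ is replacement free: in each of these calculi there exist a context $C$, a closed invisible process $I$ and a process $P$ such that $C[I]\Downarrow$ but not $C[P]\Downarrow$.
   Context: CCS$^{sg}$ (CCS with static priority and global preemption, Cleaveland–Lüttgen–Natarajan) is CCS in which channels have one of two priority levels: ordinary actions and high-priority (underlined) actions $\underline a,\underline{\overline a},\underline\tau$. Only complementary actions at the same priority level can synchronize. Restricted to ordinary (or to prioritized) actions only, the rules are those of CCS; an ordinary (unprioritized) action can be performed by a process only if that process cannot perform a prioritized invisible action $\underline\tau$. Actions other than $\tau$ and $\underline\tau$ are visible. CCS$^{\mathsf{prio}}$ extends CCS$^{sg}$ with the prioritization operator $P\lceil\mu$ (making the visible unprioritized action $\mu$ prioritized) and the deprioritization operator $P\lfloor\underline\mu$. A process is closed if it has no free names. A context is a term with one hole; $C[P]$ is hole filling. $\Rightarrow$ is the reflexive-transitive closure of invisible transitions; $P\Downarrow$ iff $P\Rightarrow\xrightarrow{\alpha}\Rightarrow P'$ for some visible $\alpha$; $P$ is invisible iff not $P\Downarrow$. A calculus is replacement free if for every context $C$, closed invisible process $I$ and process $P$, $C[I]\Downarrow$ implies $C[P]\Downarrow$. -}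

module Defs where

open import Data.Nat using (ℕ)
open import Data.Product using (Σ; _×_; _,_; ∃)
open import Data.Sum using (_⊎_)
open import Data.Empty using (⊥)
open import Data.Unit using (⊤)
open import Data.Maybe using (Maybe; just; nothing)
open import Relation.Nullary using (¬_)
open import Relation.Binary.PropositionalEquality using (_≡_; _≢_)
open import Relation.Binary.Construct.Closure.ReflexiveTransitive using (Star)

-- lo = ordinary (unprioritized), hi = prioritized (underlined)
data Level : Set where
  lo hi : Level

-- A channel is a name (ℕ) at a priority level: (lo , a) is a, (hi , a) is a̲.
Chan : Set
Chan = Level × ℕ

data Dir : Set where
  inp out : Dir

data Act : Set where
  τ   : Level → Act
  vis : Dir → Chan → Act

lvl : Act → Level
lvl (τ l) = l
lvl (vis _ (l , _)) = l

Visible : Act → Set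
Visible (τ _) = ⊥
Visible (vis _ _) = ⊤

chanOf : Act → Maybe Chan
chanOf (τ _) = nothing
chanOf (vis _ c) = just c

data Calc : Set where
  sg prio : Calc

infixr 9 _∙_
infixl 7 _⊕_
infixl 6 _∥_

data Proc : Calc → Set where
  𝟎    : ∀ {k} → Proc k
  _∙_  : ∀ {k} → Act → Proc k → Proc k
  _⊕_  : ∀ {k} → Proc k → Proc k → Proc k
  _∥_  : ∀ {k} → Proc k → Proc k → Proc k
  ν    : ∀ {k} → Chan → Proc k → Proc k
  !_   : ∀ {k} → Proc k → Proc k
  _⌈_  : Proc prio → Dir × ℕ → Proc prio
  _⌊_  : Proc prio → Dir × ℕ → Proc prio

-- Operational semantics (static priority, global preemption).
-- Defined by (well-founded, structural) mutual recursion on P, which is how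
-- the negative premise of global preemption is made admissible.

mutual
  HighTau : ∀ {k} → Proc k → Set
  HighTau {k} P = Σ (Proc k) (λ P' → Raw P (τ hi) P')

  Step : ∀ {k} → Proc k → Act → Proc k → Set
  Step P α R = Raw P α R × (lvl α ≡ lo → ¬ HighTau P)

  Raw : ∀ {k} → Proc k → Act → Proc k → Set
  Raw 𝟎 α R = ⊥
  Raw (β ∙ P) α R = β ≡ α × P ≡ R
  Raw (P ⊕ Q) α R = Step P α R ⊎ Step Q α R
  Raw {k} (P ∥ Q) α R =
      Σ (Proc k) (λ P' → Step P α P' × R ≡ (P' ∥ Q))
    ⊎ Σ (Proc k) (λ Q' → Step Q α Q' × R ≡ (P ∥ Q'))
    ⊎ Σ Chan (λ c → Σ (Proc k) (λ P' → Σ (Proc k) (λ Q' →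
         α ≡ τ (Data.Product.proj₁ c)
       × ((Step P (vis out c) P' × Step Q (vis inp c) Q')
          ⊎ (Step P (vis inp c) P' × Step Q (vis out c) Q'))
       × R ≡ (P' ∥ Q'))))
  Raw {k} (ν c P) α R =
    Σ (Proc k) (λ P' → Step P α P' × chanOf α ≢ just c × R ≡ ν c P')
  Raw {k} (! P) α R =
      Σ (Proc k) (λ P' → Step P α P' × R ≡ (P' ∥ (! P)))
    ⊎ Σ Chan (λ c → Σ (Proc k) (λ P' → Σ (Proc k) (λ P'' →
         α ≡ τ (Data.Product.proj₁ c)
       × Step P (vis out c) P' × Step P (vis inp c) P''
       × R ≡ ((P' ∥ P'') ∥ (! P)))))
  Raw (P ⌈ (d , a)) α R =
      (α ≡ vis d (hi , a) × Σ (Proc prio) (λ P' → Step P (vis d (lo , a)) P' × R ≡ (P' ⌈ (d , a))))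
    ⊎ (α ≢ vis d (lo , a) × Σ (Proc prio) (λ P' → Step P α P' × R ≡ (P' ⌈ (d , a))))
  Raw (P ⌊ (d , a)) α R =
      (α ≡ vis d (lo , a) × Σ (Proc prio) (λ P' → Step P (vis d (hi , a)) P' × R ≡ (P' ⌊ (d , a))))
    ⊎ (α ≢ vis d (hi , a) × Σ (Proc prio) (λ P' → Step P α P' × R ≡ (P' ⌊ (d , a))))

TauStep : ∀ {k} → Proc k → Proc k → Set
TauStep P Q = Σ Level (λ l → Step P (τ l) Q)

_⇒_ : ∀ {k} → Proc k → Proc k → Set
_⇒_ = Star TauStep

_⇓ : ∀ {k} → Proc k → Set
_⇓ {k} P = Σ (Proc k) (λ P₁ → Σ Act (λ α → Σ (Proc k) (λ P₂ → Σ (Proc k) (λ P' →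
             P ⇒ P₁ × Visible α × Step P₁ α P₂ × P₂ ⇒ P'))))

Invisible : ∀ {k} → Proc k → Set
Invisible P = ¬ (P ⇓)

FreeIn : ∀ {k} → Chan → Proc k → Set
FreeIn c 𝟎 = ⊥
FreeIn c (α ∙ P) = chanOf α ≡ just c ⊎ FreeIn c P
FreeIn c (P ⊕ Q) = FreeIn c P ⊎ FreeIn c Q
FreeIn c (P ∥ Q) = FreeIn c P ⊎ FreeIn c Q
FreeIn c (ν c' P) = c ≢ c' × FreeIn c P
FreeIn c (! P) = FreeIn c P
FreeIn c (P ⌈ (d , a)) = c ≡ (lo , a) ⊎ c ≡ (hi , a) ⊎ FreeIn c P
FreeIn c (P ⌊ (d , a)) = c ≡ (lo , a) ⊎ c ≡ (hi , a) ⊎ FreeIn c P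

Closed : ∀ {k} → Proc k → Set
Closed P = ∀ c → ¬ FreeIn c P

data Ctx : Calc → Set where
  []    : ∀ {k} → Ctx k
  _∙_   : ∀ {k} → Act → Ctx k → Ctx k
  _⊕ˡ_  : ∀ {k} → Ctx k → Proc k → Ctx k
  _⊕ʳ_  : ∀ {k} → Proc k → Ctx k → Ctx k
  _∥ˡ_  : ∀ {k} → Ctx k → Proc k → Ctx k
  _∥ʳ_  : ∀ {k} → Proc k → Ctx k → Ctx k
  ν     : ∀ {k} → Chan → Ctx k → Ctx k
  !_    : ∀ {k} → Ctx k → Ctx k
  _⌈_   : Ctx prio → Dir × ℕ → Ctx prio
  _⌊_   : Ctx prio → Dir × ℕ → Ctx prio

_[_] : ∀ {k} → Ctx k → Proc k → Proc k
[] [ P ] = P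
(α ∙ C) [ P ] = α ∙ (C [ P ])
(C ⊕ˡ Q) [ P ] = (C [ P ]) ⊕ Q
(Q ⊕ʳ C) [ P ] = Q ⊕ (C [ P ])
(C ∥ˡ Q) [ P ] = (C [ P ]) ∥ Q
(Q ∥ʳ C) [ P ] = Q ∥ (C [ P ])
ν c C [ P ] = ν c (C [ P ])
(! C) [ P ] = ! (C [ P ])
(C ⌈ μ) [ P ] = (C [ P ]) ⌈ μ
(C ⌊ μ) [ P ] = (C [ P ]) ⌊ μ

ReplacementFree : Calc → Set
ReplacementFree k = (C : Ctx k) (I P : Proc k) →
  Closed I → Invisible I → (C [ I ]) ⇓ → (C [ P ]) ⇓

ReplacementCounterexample : Calc → Set
ReplacementCounterexample k = Σ (Ctx k) (λ C → Σ (Proc k) (λ I → Σ (Proc k) (λ P →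
  Closed I × Invisible I × (C [ I ]) ⇓ × ¬ ((C [ P ]) ⇓))))

-- Under global preemption an available τ̲ blocks every unprioritized action of
-- the whole process. In the context a.0 + [ ], filling the hole with 0 leaves the
-- barb a, while filling it with τ̲.0 preempts a and leaves only the silent step τ̲.
-- The construction uses no ⌈/⌊, so it works in both calculi.
module Submission where

open import Defs
open import Data.Product using (_×_; _,_; proj₁; proj₂)
open import Data.Sum using (inj₁; inj₂)
open import Data.Unit using (tt)
open import Data.Empty using (⊥-elim)
open import Function using (case_of_)
open import Relation.Nullary using (¬_)
open import Relation.Binary.PropositionalEquality using (_≡_; refl)
open import Relation.Binary.Construct.Closure.ReflexiveTransitive using (ε; _◅_)

step⇒⇓ : ∀ {k} {P R : Proc k} {α : Act} → Visible α → Step P α R → P ⇓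
step⇒⇓ v s = _ , _ , _ , _ , ε , v , s , ε

invisible-if-steps-invisible : ∀ {k} {P : Proc k} →
  (∀ {α R} → Step P α R → ¬ Visible α × Invisible R) → Invisible P
invisible-if-steps-invisible h (_ , _ , _ , _ , ε , v , s , _) = proj₁ (h s) v
invisible-if-steps-invisible h (P₁ , α , P₂ , P' , (_ , s) ◅ t , rest) =
  proj₂ (h s) (P₁ , α , P₂ , P' , t , rest)

𝟎-invisible : ∀ {k} → Invisible {k} 𝟎
𝟎-invisible = invisible-if-steps-invisible λ { (() , _) }

𝟎-closed : ∀ {k} → Closed {k} 𝟎
𝟎-closed _ ()

preempted-choice-steps : ∀ {k} {μ : Act} {P Q R : Proc k} {α : Act} → lvl μ ≡ lo →
  Step ((μ ∙ P) ⊕ (τ hi ∙ Q)) α R → α ≡ τ hi × R ≡ Q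
preempted-choice-steps {Q = Q} lo≡ (inj₁ ((refl , refl) , _) , preempt) =
  ⊥-elim (preempt lo≡ (Q , inj₂ ((refl , refl) , λ ())))
preempted-choice-steps _ (inj₂ ((refl , refl) , _) , _) = refl , refl

preempted-choice-invisible : ∀ {k} {μ : Act} {P Q : Proc k} → lvl μ ≡ lo →
  Invisible Q → Invisible ((μ ∙ P) ⊕ (τ hi ∙ Q))
preempted-choice-invisible lo≡ invQ = invisible-if-steps-invisible λ s →
  case preempted-choice-steps lo≡ s of λ { (refl , refl) → (λ ()) , invQ }

barb : Act
barb = vis out (lo , 0)

barb-context : ∀ {k} → Ctx k
barb-context = (barb ∙ 𝟎) ⊕ʳ []

barb-with-𝟎 : ∀ {k} → (barb-context {k} [ 𝟎 ]) ⇓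
barb-with-𝟎 = step⇒⇓ tt (inj₁ ((refl , refl) , λ _ ()) , λ _ → no-highTau)
  where
  no-highTau : ¬ HighTau ((barb ∙ 𝟎) ⊕ 𝟎)
  no-highTau (_ , inj₁ ((() , _) , _))
  no-highTau (_ , inj₂ (() , _))

counterexample : ∀ {k} → ReplacementCounterexample k
counterexample {k} =
  barb-context , 𝟎 , τ hi ∙ 𝟎 , 𝟎-closed {k} , 𝟎-invisible , barb-with-𝟎 ,
  preempted-choice-invisible refl 𝟎-invisible

proposition5p3 : ReplacementCounterexample sg × ReplacementCounterexample prio
proposition5p3 = counterexample , counterexample
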